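{- Let $p$ be a prime, $\omega=e^{2\pi i/p}$, $g$ a primitive element of $\mathbb{F}_p^*$, and for $u\in\mathbb{F}_p^*$ let $\mathcal{K}(u)=\sum_{x\in\mathbb{F}_p^*}\omega^{x+u/x}$. Let $\mathbf{K}$ be the $(p-1)\times(p-1)$ left-circulant matrix with first row $(k_0,\ldots,k_{p-2})$, $k_l=\mathcal{K}(g^l)+p+1$, and let $\mathbf{K}'$ be the $(p-1)\times(p-1)$ left-circulant matrix with first row $(\mathcal{K}(1),\mathcal{K}(g),\ldots,\mathcal{K}(g^{p-2}))$. Then $\det\mathbf{K}=p^2\det\mathbf{K}'$.
   Context: An $n\times n$ matrix is left-circulant with first row $(a_0,\ldots,a_{n-1})$ if its $(i,j)$ entry (indices from $0$) is $a_{(i+j)\bmod n}$. -}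

module Defs where

open import Data.Nat as ℕ using (ℕ; zero; suc; NonZero; _%_; _∸_; _<_; _^_)
open import Data.Nat.DivMod using (m%n<n)
open import Data.Integer as ℤ using (ℤ)
open import Data.Fin using (Fin; toℕ; fromℕ<; punchIn)
import Data.Fin as Fin
open import Data.List using (List; []; _∷_; upTo)
open import Data.Product using (∃; _×_)
open import Relation.Binary.PropositionalEquality using (_≡_; _≢_)
open import Relation.Nullary using (yes; no)

IsPrimitiveRoot : (p : ℕ) .{{_ : NonZero p}} → ℕ → Set
IsPrimitiveRoot p g =
  (g % p ≢ 0) × (∀ k → 0 < k → k < p ∸ 1 → (g ^ k) % p ≢ 1)

sumFin : {A : Set} → A → (A → A → A) → (n : ℕ) → (Fin n → A) → A
sumFin z _+_ zero    f = z
sumFin z _+_ (suc n) f = f Fin.zero + sumFin z _+_ n (λ i → f (Fin.suc i))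

-- The cyclotomic ring ℤ[ω], ω = e^{2πi/p}, realised as the group ring ℤ[C_p]
-- (f : Fin p → ℤ stands for Σ_i f(i) ω^i) modulo the relation
-- "f - g has all coefficients equal", i.e. modulo (1 + ω + ... + ω^{p-1}).
-- For p prime this is exactly ℤ[ω] ⊂ ℂ with its equality.
module Cyc (p : ℕ) .{{_ : NonZero p}} where

  R : Set
  R = Fin p → ℤ

  idx : ℕ → Fin p
  idx m = fromℕ< (m%n<n m p)

  _≈_ : R → R → Set
  f ≈ g = ∃ λ (c : ℤ) → ∀ i → f i ℤ.- g i ≡ c

  0R : R
  0R _ = ℤ.0ℤ

  const : ℤ → R
  const c Fin.zero    = c
  const c (Fin.suc _) = ℤ.0ℤ

  1R : R
  1R = const ℤ.1ℤ

  _+R_ : R → R → R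
  (f +R g) i = f i ℤ.+ g i

  -R_ : R → R
  (-R f) i = ℤ.- f i

  _*R_ : R → R → R
  (f *R g) k = sumFin ℤ.0ℤ ℤ._+_ p
                 (λ i → f i ℤ.* g (idx (toℕ k ℕ.+ (p ∸ toℕ i))))

  ωpow : ℕ → R
  ωpow n i with toℕ i ℕ.≟ (n % p)
  ... | yes _ = ℤ.1ℤ
  ... | no  _ = ℤ.0ℤ

  sumR : (n : ℕ) → (Fin n → R) → R
  sumR = sumFin 0R _+R_

  det : (n : ℕ) → (Fin n → Fin n → R) → R
  det zero    M = 1R
  det (suc n) M = sumR (suc n) (λ j →
      sign (toℕ j) *R (M Fin.zero j *R det n (λ i k → M (Fin.suc i) (punchIn j k))))
    where
    sign : ℕ → R
    sign zero          = 1R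
    sign (suc zero)    = -R 1R
    sign (suc (suc m)) = sign m

  -- u / x in F_p: the unique y ∈ {0,…,p-1} with x·y ≡ u (mod p) (found by search)
  divp : ℕ → ℕ → ℕ
  divp u x = search (upTo p)
    where
    search : List ℕ → ℕ
    search []       = 0
    search (y ∷ ys) with ((x ℕ.* y) % p) ℕ.≟ (u % p)
    ... | yes _ = y
    ... | no  _ = search ys

  Kl : ℕ → R
  Kl u = sumR (p ∸ 1) (λ i → let x = suc (toℕ i) in ωpow (x ℕ.+ divp u x))

  leftCirc : (n : ℕ) → (ℕ → R) → Fin n → Fin n → R
  leftCirc zero    a ()
  leftCirc (suc m) a i j = a ((toℕ i ℕ.+ toℕ j) % suc m)

  Kmat : ℕ → Fin (p ∸ 1) → Fin (p ∸ 1) → R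
  Kmat g = leftCirc (p ∸ 1) (λ l → Kl (g ^ l) +R const (ℤ.+ (p ℕ.+ 1)))

  Kmat' : ℕ → Fin (p ∸ 1) → Fin (p ∸ 1) → R
  Kmat' g = leftCirc (p ∸ 1) (λ l → Kl (g ^ l))

{-# OPTIONS --safe #-}
-- Write S(a) = Σ_l a_l.  Adding all rows of the left-circulant matrix with first row a to its first row
-- and factoring out S(a) gives det = S(a)·D(a), where D(a) is the determinant with first row 1, …, 1;
-- and D(a + c) = D(a) for a constant c, since subtracting c times the first row from the others undoes
-- the shift.  With a_l = K(g^l) this gives det K = (S(a) + (p-1)(p+1))·D and det K' = S(a)·D.  As g^l
-- runs over F_p^*, S(a) = Σ_{x≠0} ω^x Σ_{y≠0} ω^y = 1 in ℤ[ω], so det K = p²·D = p²·det K'.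
-- The computation is carried out exactly in the group ring ℤ[C_p], where S(a) = (p-2)J + 1 with
-- J = 1 + ω + ⋯ + ω^(p-1); multiples of J vanish in ℤ[ω] and are dropped only at the end.
module Submission where

open import Defs
open import Data.Nat using (ℕ; zero; suc; NonZero)
open import Data.Nat.Primality using (Prime)
open import Algebra using (CommutativeRing)

module Modular (n : ℕ) .{{_ : NonZero n}} where
  open import Data.Nat
  open import Data.Nat.Properties
  open import Data.Nat.DivMod
  open import Data.Fin using (Fin; toℕ)
  open import Data.Fin.Properties using (toℕ<n; toℕ-fromℕ<; toℕ-injective)
  open import Function.Definitions using (Injective)
  open import Relation.Binary.PropositionalEquality
  open ≡-Reasoning

  %-cong-+ʳ : ∀ {a b} t → a % n ≡ b % n → (a + t) % n ≡ (b + t) % n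
  %-cong-+ʳ {a} {b} t e = begin
    (a + t) % n           ≡⟨ %-distribˡ-+ a t n ⟩
    (a % n + t % n) % n   ≡⟨ cong (λ x → (x + t % n) % n) e ⟩
    (b % n + t % n) % n   ≡⟨ %-distribˡ-+ b t n ⟨
    (b + t) % n           ∎

  -- j + (n ∸ j % n) is a multiple of n, so adding it undoes adding j.
  %-cancelʳ-+ : ∀ a b j → (a + j) % n ≡ (b + j) % n → a % n ≡ b % n
  %-cancelʳ-+ a b j e = begin
    a % n                     ≡⟨ [m+kn]%n≡m%n a (suc (j / n)) n ⟨
    (a + suc (j / n) * n) % n ≡⟨ shift a ⟨
    ((a + j) + t) % n         ≡⟨ %-cong-+ʳ t e ⟩
    ((b + j) + t) % n         ≡⟨ shift b ⟩
    (b + suc (j / n) * n) % n ≡⟨ [m+kn]%n≡m%n b (suc (j / n)) n ⟩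
    b % n                     ∎
    where
    t = n ∸ j % n
    j+t≡ : j + t ≡ suc (j / n) * n
    j+t≡ = begin
      j + t                         ≡⟨ cong (_+ t) (m≡m%n+[m/n]*n j n) ⟩
      (j % n + j / n * n) + t       ≡⟨ cong (_+ t) (+-comm (j % n) _) ⟩
      (j / n * n + j % n) + t       ≡⟨ +-assoc (j / n * n) _ _ ⟩
      j / n * n + (j % n + t)       ≡⟨ cong (j / n * n +_) (m+[n∸m]≡n (m%n≤n j n)) ⟩
      j / n * n + n                 ≡⟨ +-comm (j / n * n) n ⟩
      suc (j / n) * n               ∎
    shift : ∀ x → ((x + j) + t) % n ≡ (x + suc (j / n) * n) % n
    shift x = cong (_% n) (trans (+-assoc x j t) (cong (x +_) j+t≡))

  %-absorbˡ-+ : ∀ a b → (a % n + b) % n ≡ (a + b) % n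
  %-absorbˡ-+ a b = %-cong-+ʳ b (m%n%n≡m%n a n)

  %-absorbʳ-+ : ∀ a b → (a + b % n) % n ≡ (a + b) % n
  %-absorbʳ-+ a b = begin
    (a + b % n) % n ≡⟨ cong (_% n) (+-comm a _) ⟩
    (b % n + a) % n ≡⟨ %-absorbˡ-+ b a ⟩
    (b + a) % n     ≡⟨ cong (_% n) (+-comm b a) ⟩
    (a + b) % n     ∎

  toℕ-% : (i : Fin n) → toℕ i % n ≡ toℕ i
  toℕ-% i = m<n⇒m%n≡m (toℕ<n i)

  toℕ-mod : ∀ m → toℕ (m mod n) ≡ m % n
  toℕ-mod m = toℕ-fromℕ< _

  toℕ-%-injective : ∀ {i j : Fin n} → toℕ i % n ≡ toℕ j % n → i ≡ j
  toℕ-%-injective {i} {j} e = toℕ-injective (trans (sym (toℕ-% i)) (trans e (toℕ-% j)))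

  infixl 6 _⊕_ _⊖_

  _⊕_ : Fin n → Fin n → Fin n
  i ⊕ j = (toℕ i + toℕ j) mod n

  _⊖_ : Fin n → Fin n → Fin n
  k ⊖ i = (toℕ k + (n ∸ toℕ i)) mod n

  toℕ-⊕ : ∀ i j → toℕ (i ⊕ j) ≡ (toℕ i + toℕ j) % n
  toℕ-⊕ i j = toℕ-mod _

  ⊕-cancelʳ : ∀ j → Injective _≡_ _≡_ (_⊕ j)
  ⊕-cancelʳ j {i} {i′} e = toℕ-%-injective (%-cancelʳ-+ (toℕ i) (toℕ i′) (toℕ j)
    (trans (sym (toℕ-⊕ i j)) (trans (cong toℕ e) (toℕ-⊕ i′ j))))

  ⊖-+ : ∀ k i → (toℕ (k ⊖ i) + toℕ i) % n ≡ toℕ k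
  ⊖-+ k i = begin
    (toℕ (k ⊖ i) + toℕ i) % n                 ≡⟨ cong (λ x → (x + toℕ i) % n) (toℕ-mod _) ⟩
    ((toℕ k + (n ∸ toℕ i)) % n + toℕ i) % n   ≡⟨ %-absorbˡ-+ _ (toℕ i) ⟩
    (toℕ k + (n ∸ toℕ i) + toℕ i) % n         ≡⟨ cong (_% n) (+-assoc (toℕ k) _ _) ⟩
    (toℕ k + ((n ∸ toℕ i) + toℕ i)) % n       ≡⟨ cong (λ x → (toℕ k + x) % n) (m∸n+n≡m (<⇒≤ (toℕ<n i))) ⟩
    (toℕ k + n) % n                           ≡⟨ [m+n]%n≡m%n (toℕ k) n ⟩
    toℕ k % n                                 ≡⟨ toℕ-% k ⟩
    toℕ k                                     ∎

  ⊖-unique : ∀ {x k i} → (toℕ x + toℕ i) % n ≡ toℕ k → x ≡ k ⊖ i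
  ⊖-unique {x} {k} {i} e = toℕ-%-injective (%-cancelʳ-+ (toℕ x) (toℕ (k ⊖ i)) (toℕ i) (trans e (sym (⊖-+ k i))))

  ⊖-identityʳ : ∀ k → k ⊖ (0 mod n) ≡ k
  ⊖-identityʳ k = sym (⊖-unique (begin
    (toℕ k + toℕ (0 mod n)) % n  ≡⟨ cong (λ x → (toℕ k + x) % n) (toℕ-mod 0) ⟩
    (toℕ k + 0 % n) % n          ≡⟨ %-absorbʳ-+ (toℕ k) 0 ⟩
    (toℕ k + 0) % n              ≡⟨ cong (_% n) (+-identityʳ (toℕ k)) ⟩
    toℕ k % n                    ≡⟨ toℕ-% k ⟩
    toℕ k                        ∎))

  ⊖-involutive : ∀ k i → k ⊖ (k ⊖ i) ≡ i
  ⊖-involutive k i = sym (⊖-unique (trans (cong (_% n) (+-comm (toℕ i) _)) (⊖-+ k i)))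

  ⊖-⊖ : ∀ k i j → (k ⊖ j) ⊖ (i ⊖ j) ≡ k ⊖ i
  ⊖-⊖ k i j = sym (⊖-unique (begin
    (A + B) % n           ≡⟨ %-cancelʳ-+ (A + B) (toℕ (k ⊖ j)) (toℕ j) (begin
      (A + B + toℕ j) % n        ≡⟨ cong (_% n) (+-assoc A B (toℕ j)) ⟩
      (A + (B + toℕ j)) % n      ≡⟨ %-absorbʳ-+ A (B + toℕ j) ⟨
      (A + (B + toℕ j) % n) % n  ≡⟨ cong (λ x → (A + x) % n) (⊖-+ i j) ⟩
      (A + toℕ i) % n            ≡⟨ ⊖-+ k i ⟩
      toℕ k                      ≡⟨ ⊖-+ k j ⟨
      (toℕ (k ⊖ j) + toℕ j) % n  ∎) ⟩
    toℕ (k ⊖ j) % n       ≡⟨ toℕ-% (k ⊖ j) ⟩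
    toℕ (k ⊖ j)           ∎))
    where
    A = toℕ (k ⊖ i)
    B = toℕ (i ⊖ j)

  ⊖-cancelˡ : ∀ k → Injective _≡_ _≡_ (k ⊖_)
  ⊖-cancelˡ k {i} {i′} e = trans (sym (⊖-involutive k i)) (trans (cong (k ⊖_) e) (⊖-involutive k i′))

  ⊖-cancelʳ : ∀ j → Injective _≡_ _≡_ (_⊖ j)
  ⊖-cancelʳ j {i} {i′} e = toℕ-injective (trans (sym (⊖-+ i j))
    (trans (cong (λ x → (toℕ x + toℕ j) % n) e) (⊖-+ i′ j)))

module FinProperties where
  open import Data.Fin using (Fin; zero; suc; punchIn; punchOut)
  open import Data.Fin.Properties using (any?; _≟_; injective⇒≤; punchOut-injective)
  open import Function.Base using (_∘_)
  open import Data.Nat.Properties using (1+n≰n)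
  open import Data.Product using (∃; _,_)
  open import Function.Definitions using (Injective)
  open import Relation.Binary.PropositionalEquality using (_≡_; _≢_; refl; sym; cong)
  open import Relation.Nullary using (yes; no; contradiction)

  -- An injection missing t would push Fin (suc n) into Fin n after punching t out.
  injective⇒surjective : ∀ {n} {f : Fin n → Fin n} → Injective _≡_ _≡_ f → ∀ t → ∃ λ i → f i ≡ t
  injective⇒surjective {suc n} {f} inj t with any? (λ i → f i ≟ t)
  ... | yes hit = hit
  ... | no miss = contradiction (injective⇒≤ punchOut-f-injective) 1+n≰n
    where
    missed : ∀ i → t ≢ f i
    missed i e = miss (i , sym e)
    punchOut-f-injective : Injective _≡_ _≡_ (λ i → punchOut (missed i))
    punchOut-f-injective e = inj (punchOut-injective (missed _) (missed _) e)

  punchIn-punchOut-swap : ∀ {m} {a c : Fin (suc (suc m))} (a≢c : a ≢ c) (c≢a : c ≢ a) l →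
                          punchIn a (punchIn (punchOut a≢c) l) ≡ punchIn c (punchIn (punchOut c≢a) l)
  punchIn-punchOut-swap {a = zero}  {zero}  a≢c _ l = contradiction refl a≢c
  punchIn-punchOut-swap {a = zero}  {suc c} _ _ l = refl
  punchIn-punchOut-swap {a = suc a} {zero}  _ _ l = refl
  punchIn-punchOut-swap {suc m} {suc a} {suc c} _ _ zero = refl
  punchIn-punchOut-swap {suc m} {suc a} {suc c} a≢c c≢a (suc l) =
    cong suc (punchIn-punchOut-swap (a≢c ∘ cong suc) (c≢a ∘ cong suc) l)

module FiniteSums {c ℓ} (R : CommutativeRing c ℓ) where
  open CommutativeRing R hiding (zero)
  open import Algebra.Properties.Semiring.Sum semiring public
  open import Algebra.Properties.Ring ring using (-1*x≈-x)
  open import Data.Fin using (Fin; zero; suc; punchIn; punchOut)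
  open import Data.Fin.Properties using (punchIn-punchOut; punchOut-injective; suc-injective)
  open import Function.Definitions using (Injective)
  open import Function.Base using (_∘_)
  import Relation.Binary.PropositionalEquality as ≡
  open import Relation.Binary.Reasoning.Setoid setoid

  sum-cong : ∀ {n} {f g : Fin n → Carrier} → (∀ i → f i ≈ g i) → sum f ≈ sum g
  sum-cong = sum-cong-≋

  sum-zero : ∀ {n} {f : Fin n → Carrier} → (∀ i → f i ≈ 0#) → sum f ≈ 0#
  sum-zero {n} f≈0 = trans (sum-cong f≈0) (sum-replicate-zero n)

  -‿distrib-sum : ∀ {n} (f : Fin n → Carrier) → - sum f ≈ ∑[ i < n ] (- f i)
  -‿distrib-sum f = begin
    - sum f                   ≈⟨ -1*x≈-x (sum f) ⟨
    - 1# * sum f              ≈⟨ *-distribˡ-sum (- 1#) f ⟩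
    ∑[ i < _ ] (- 1# * f i)   ≈⟨ sum-cong (λ i → -1*x≈-x (f i)) ⟩
    ∑[ i < _ ] (- f i)        ∎

  sum-reindex : ∀ {n} (σ : Fin n → Fin n) → Injective ≡._≡_ ≡._≡_ σ →
                ∀ f → ∑[ i < n ] f (σ i) ≈ sum f
  sum-reindex {zero} σ inj f = refl
  sum-reindex {suc n} σ inj f = begin
    f (σ zero) + ∑[ i < n ] f (σ (suc i))
      ≈⟨ +-congˡ (reflexive (sum-cong-≗ (λ i → ≡.cong f (≡.sym (punchIn-punchOut (avoids i)))))) ⟩
    f (σ zero) + ∑[ i < n ] f (punchIn (σ zero) (τ i))
      ≈⟨ +-congˡ (sum-reindex τ τ-injective (f ∘ punchIn (σ zero))) ⟩
    f (σ zero) + ∑[ i < n ] f (punchIn (σ zero) i)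
      ≈⟨ sum-remove f ⟨
    sum f ∎
    where
    avoids : ∀ i → σ zero ≡.≢ σ (suc i)
    avoids i e with () ← inj e
    τ : Fin n → Fin n
    τ i = punchOut (avoids i)
    τ-injective : Injective ≡._≡_ ≡._≡_ τ
    τ-injective e = suc-injective (inj (punchOut-injective (avoids _) (avoids _) e))

  sum-linear : ∀ {n} x {f g h : Fin n → Carrier} → (∀ i → f i ≈ x * g i + h i) →
               sum f ≈ x * sum g + sum h
  sum-linear {n} x {f} {g} {h} f≈ = begin
    sum f                              ≈⟨ sum-cong f≈ ⟩
    ∑[ i < n ] (x * g i + h i)         ≈⟨ ∑-distrib-+ (λ i → x * g i) h ⟩
    ∑[ i < n ] (x * g i) + sum h       ≈⟨ +-congʳ (*-distribˡ-sum x g) ⟨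
    x * sum g + sum h                  ∎

module Determinant {c ℓ} (R : CommutativeRing c ℓ) where
  open import Level using (_⊔_)
  open CommutativeRing R hiding (zero)
  open FiniteSums R
  open FinProperties using (punchIn-punchOut-swap)
  open import Algebra.Properties.Ring ring using (-‿involutive; -‿distribˡ-*; -‿distribʳ-*; -0#≈0#)
  open import Algebra.Solver.CommutativeMonoid *-commutativeMonoid using (solve; _⊕_; _⊜_)
  import Data.Nat as ℕ
  import Data.Nat.Properties as ℕ
  open import Data.Fin using (Fin; zero; suc; toℕ; fromℕ<; punchIn; punchOut)
  open import Data.Fin.Properties
    using (_≟_; suc-injective; toℕ<n; toℕ-fromℕ<; toℕ-injective; punchInᵢ≢i; punchOut-punchIn; punchOut-cong)
  open import Data.Product using (_×_; _,_; proj₁; proj₂)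
  open import Data.Vec.Functional using (updateAt)
  open import Data.Vec.Functional.Properties using (updateAt-updates; updateAt-minimal)
  open import Function.Base using (_∘_; _$_)
  import Relation.Binary.PropositionalEquality as ≡
  open import Relation.Nullary using (Dec; yes; no; contradiction)
  open import Relation.Binary.Reasoning.Setoid setoid

  Matrix : ℕ → Set c
  Matrix n = Fin n → Fin n → Carrier

  sign : ℕ → Carrier
  sign zero          = 1#
  sign (suc zero)    = - 1#
  sign (suc (suc k)) = sign k

  sign-suc : ∀ k → sign (suc k) ≈ - sign k
  sign-suc zero          = refl
  sign-suc (suc zero)    = sym (-‿involutive 1#)
  sign-suc (suc (suc k)) = sign-suc k

  minor : ∀ {n} → Matrix (suc n) → Fin (suc n) → Matrix n
  minor M j i k = M (suc i) (punchIn j k)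

  det : ∀ n → Matrix n → Carrier
  det zero    M = 1#
  det (suc n) M = ∑[ j < suc n ] (sign (toℕ j) * (M zero j * det n (minor M j)))

  laplaceTerm : ∀ {n} → Matrix (suc n) → Fin (suc n) → Carrier
  laplaceTerm {n} M j = sign (toℕ j) * (M zero j * det n (minor M j))

  det-cong : ∀ n {M N : Matrix n} → (∀ i j → M i j ≈ N i j) → det n M ≈ det n N
  det-cong zero    M≈N = refl
  det-cong (suc n) {M} {N} M≈N = sum-cong {f = laplaceTerm M} {laplaceTerm N} λ j →
    *-congˡ (*-cong (M≈N zero j) (det-cong n (λ i k → M≈N (suc i) (punchIn j k))))

  withRow₀ : ∀ {n} → Matrix (suc n) → (Fin (suc n) → Carrier) → Matrix (suc n)
  withRow₀ M v zero    = v
  withRow₀ M v (suc i) = M (suc i)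

  det-withRow₀-sum : ∀ {n k} (M : Matrix (suc n)) (v : Fin k → Fin (suc n) → Carrier) →
                     det (suc n) (withRow₀ M (λ j → ∑[ t < k ] v t j)) ≈ ∑[ t < k ] det (suc n) (withRow₀ M (v t))
  det-withRow₀-sum {n} {k} M v = begin
    ∑[ j < suc n ] (sign (toℕ j) * (∑[ t < k ] v t j * d j))
      ≈⟨ sum-cong {f = λ j → sign (toℕ j) * (∑[ t < k ] v t j * d j)} (λ j → begin
        sign (toℕ j) * (∑[ t < k ] v t j * d j)    ≈⟨ *-congˡ (*-distribʳ-sum (d j) (λ t → v t j)) ⟩
        sign (toℕ j) * ∑[ t < k ] (v t j * d j)    ≈⟨ *-distribˡ-sum (sign (toℕ j)) (λ t → v t j * d j) ⟩
        ∑[ t < k ] (sign (toℕ j) * (v t j * d j))  ∎) ⟩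
    ∑[ j < suc n ] ∑[ t < k ] (sign (toℕ j) * (v t j * d j))
      ≈⟨ ∑-comm (λ j t → sign (toℕ j) * (v t j * d j)) ⟩
    ∑[ t < k ] ∑[ j < suc n ] (sign (toℕ j) * (v t j * d j)) ∎
    where
    d : Fin (suc n) → Carrier
    d j = det n (minor M j)

  det-withRow₀-constant : ∀ {n} (M : Matrix (suc n)) x →
                          det (suc n) (withRow₀ M (λ _ → x)) ≈ x * det (suc n) (withRow₀ M (λ _ → 1#))
  det-withRow₀-constant {n} M x = sym (begin
    x * ∑[ j < suc n ] (sign (toℕ j) * (1# * d j))  ≈⟨ *-distribˡ-sum x (λ j → sign (toℕ j) * (1# * d j)) ⟩
    ∑[ j < suc n ] (x * (sign (toℕ j) * (1# * d j))) ≈⟨ sum-cong {f = λ j → x * (sign (toℕ j) * (1# * d j))} (λ j → begin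
      x * (sign (toℕ j) * (1# * d j))  ≈⟨ *-congˡ (*-congˡ (*-identityˡ (d j))) ⟩
      x * (sign (toℕ j) * d j)         ≈⟨ solve 3 (λ x s d → x ⊕ (s ⊕ d) ⊜ s ⊕ (x ⊕ d)) refl x (sign (toℕ j)) (d j) ⟩
      sign (toℕ j) * (x * d j)         ∎) ⟩
    ∑[ j < suc n ] (sign (toℕ j) * (x * d j))      ∎)
    where
    d : Fin (suc n) → Carrier
    d j = det n (minor M j)

  det-linear : ∀ n {M N P : Matrix (suc n)} r x →
               (∀ j → M r j ≈ x * N r j + P r j) →
               (∀ i → i ≡.≢ r → ∀ j → M i j ≈ N i j × M i j ≈ P i j) →
               det (suc n) M ≈ x * det (suc n) N + det (suc n) P
  det-linear n {M} {N} {P} zero x row₀ others =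
    sum-linear x {laplaceTerm M} {laplaceTerm N} {laplaceTerm P} λ j → begin
      sign (toℕ j) * (M zero j * det n (minor M j))              ≈⟨ *-congˡ (*-congʳ (row₀ j)) ⟩
      sign (toℕ j) * ((x * N zero j + P zero j) * det n (minor M j)) ≈⟨ distrib-row₀ (sign (toℕ j)) x _ _ _ ⟩
      x * (sign (toℕ j) * (N zero j * det n (minor M j))) + sign (toℕ j) * (P zero j * det n (minor M j))
        ≈⟨ +-cong (*-congˡ (*-congˡ (*-congˡ (minors≈ proj₁ j)))) (*-congˡ (*-congˡ (minors≈ proj₂ j))) ⟩
      x * laplaceTerm N j + laplaceTerm P j                      ∎
    where
    minors≈ : ∀ {Q : Matrix (suc n)} → (∀ {i} {j} → M i j ≈ N i j × M i j ≈ P i j → M i j ≈ Q i j) →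
              ∀ j → det n (minor M j) ≈ det n (minor Q j)
    minors≈ pick j = det-cong n (λ i k → pick (others (suc i) (λ ()) (punchIn j k)))
    distrib-row₀ : ∀ s x a b d → s * ((x * a + b) * d) ≈ x * (s * (a * d)) + s * (b * d)
    distrib-row₀ s x a b d = begin
      s * ((x * a + b) * d)             ≈⟨ *-congˡ (distribʳ d (x * a) b) ⟩
      s * (x * a * d + b * d)           ≈⟨ distribˡ s _ _ ⟩
      s * (x * a * d) + s * (b * d)     ≈⟨ +-congʳ (solve 4 (λ s x a d → s ⊕ ((x ⊕ a) ⊕ d) ⊜ x ⊕ (s ⊕ (a ⊕ d))) refl s x a d) ⟩
      x * (s * (a * d)) + s * (b * d)   ∎
  det-linear (suc n) {M} {N} {P} (suc r) x row others =
    sum-linear x {laplaceTerm M} {laplaceTerm N} {laplaceTerm P} λ j → begin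
      sign (toℕ j) * (M zero j * det (suc n) (minor M j))
        ≈⟨ *-congˡ (*-congˡ (det-linear n r x (λ k → row (punchIn j k))
                                          (λ i i≢r k → others (suc i) (i≢r ∘ suc-injective) (punchIn j k)))) ⟩
      sign (toℕ j) * (M zero j * (x * det (suc n) (minor N j) + det (suc n) (minor P j)))
        ≈⟨ distrib-row (sign (toℕ j)) (M zero j) x _ _ ⟩
      x * (sign (toℕ j) * (M zero j * det (suc n) (minor N j))) + sign (toℕ j) * (M zero j * det (suc n) (minor P j))
        ≈⟨ +-cong (*-congˡ (*-congˡ (*-congʳ (proj₁ (row₀ j))))) (*-congˡ (*-congʳ (proj₂ (row₀ j)))) ⟩
      x * laplaceTerm N j + laplaceTerm P j ∎
    where
    row₀ : ∀ j → M zero j ≈ N zero j × M zero j ≈ P zero j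
    row₀ = others zero (λ ())
    distrib-row : ∀ s m x a b → s * (m * (x * a + b)) ≈ x * (s * (m * a)) + s * (m * b)
    distrib-row s m x a b = begin
      s * (m * (x * a + b))             ≈⟨ *-congˡ (distribˡ m (x * a) b) ⟩
      s * (m * (x * a) + m * b)         ≈⟨ distribˡ s _ _ ⟩
      s * (m * (x * a)) + s * (m * b)   ≈⟨ +-congʳ (solve 4 (λ s m x a → s ⊕ (m ⊕ (x ⊕ a)) ⊜ x ⊕ (s ⊕ (m ⊕ a))) refl s m x a) ⟩
      x * (s * (m * a)) + s * (m * b)   ∎

  swapRows₀₁ : ∀ {n} → Matrix (suc (suc n)) → Matrix (suc (suc n))
  swapRows₀₁ M zero          = M (suc zero)
  swapRows₀₁ M (suc zero)    = M zero
  swapRows₀₁ M (suc (suc i)) = M (suc (suc i))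

  sign-punchOut : ∀ {m} {a c : Fin (suc (suc m))} (a≢c : a ≡.≢ c) (c≢a : c ≡.≢ a) →
                  sign (toℕ a) * sign (toℕ (punchOut a≢c)) ≈ - (sign (toℕ c) * sign (toℕ (punchOut c≢a)))
  sign-punchOut {a = zero} {zero} a≢c _ = contradiction ≡.refl a≢c
  sign-punchOut {a = zero} {suc c} _ _ = begin
    1# * sign (toℕ c)          ≈⟨ *-identityˡ _ ⟩
    sign (toℕ c)               ≈⟨ -‿involutive _ ⟨
    - (- sign (toℕ c))         ≈⟨ -‿cong (sign-suc (toℕ c)) ⟨
    - sign (suc (toℕ c))       ≈⟨ -‿cong (*-identityʳ _) ⟨
    - (sign (suc (toℕ c)) * 1#) ∎
  sign-punchOut {a = suc a} {zero} _ _ = begin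
    sign (suc (toℕ a)) * 1#    ≈⟨ *-identityʳ _ ⟩
    sign (suc (toℕ a))         ≈⟨ sign-suc (toℕ a) ⟩
    - sign (toℕ a)             ≈⟨ -‿cong (*-identityˡ _) ⟨
    - (1# * sign (toℕ a))      ∎
  sign-punchOut {zero} {suc zero} {suc zero} a≢c _ = contradiction ≡.refl a≢c
  sign-punchOut {suc m} {suc a} {suc c} a≢c c≢a = begin
    sign (suc (toℕ a)) * sign (suc (toℕ p))  ≈⟨ *-cong (sign-suc (toℕ a)) (sign-suc (toℕ p)) ⟩
    - sign (toℕ a) * - sign (toℕ p)          ≈⟨ -x*-y≈x*y _ _ ⟩
    sign (toℕ a) * sign (toℕ p)              ≈⟨ sign-punchOut a≢c′ c≢a′ ⟩
    - (sign (toℕ c) * sign (toℕ q))          ≈⟨ -‿cong (-x*-y≈x*y _ _) ⟨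
    - (- sign (toℕ c) * - sign (toℕ q))      ≈⟨ -‿cong (*-cong (sign-suc (toℕ c)) (sign-suc (toℕ q))) ⟨
    - (sign (suc (toℕ c)) * sign (suc (toℕ q))) ∎
    where
    a≢c′ = a≢c ∘ ≡.cong suc
    c≢a′ = c≢a ∘ ≡.cong suc
    p = punchOut a≢c′
    q = punchOut c≢a′
    -x*-y≈x*y : ∀ x y → - x * - y ≈ x * y
    -x*-y≈x*y x y = begin
      - x * - y      ≈⟨ -‿distribˡ-* x (- y) ⟨
      - (x * - y)    ≈⟨ -‿cong (-‿distribʳ-* x y) ⟨
      - - (x * y)    ≈⟨ -‿involutive _ ⟩
      x * y          ∎

  -- Expanding along rows 0 and 1, the term deleting columns a then c and the term deleting c then a
  -- share their minor (punchIn-punchOut-swap) and have opposite signs (sign-punchOut).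
  module DoubleExpansion {m} (M : Matrix (suc (suc m))) where
    Row : Set c
    Row = Fin (suc (suc m)) → Carrier

    cofactor₂ : Fin (suc (suc m)) → Fin (suc m) → Carrier
    cofactor₂ a b = det m (minor (minor M a) b)

    expansion : Row → Row → Carrier
    expansion X Y = ∑[ a < suc (suc m) ] (sign (toℕ a) * (X a *
                    ∑[ b < suc m ] (sign (toℕ b) * (Y (punchIn a b) * cofactor₂ a b))))

    pairTerm′ : Row → Row → (a c : Fin (suc (suc m))) → Dec (a ≡.≡ c) → Carrier
    pairTerm′ X Y a c (yes _)  = 0#
    pairTerm′ X Y a c (no a≢c) =
      sign (toℕ a) * (X a * (sign (toℕ (punchOut a≢c)) * (Y c * cofactor₂ a (punchOut a≢c))))

    pairTerm : Row → Row → (a c : Fin (suc (suc m))) → Carrier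
    pairTerm X Y a c = pairTerm′ X Y a c (a ≟ c)

    pairTerm-diagonal : ∀ X Y a → pairTerm X Y a a ≈ 0#
    pairTerm-diagonal X Y a with a ≟ a
    ... | yes _   = refl
    ... | no a≢a = contradiction ≡.refl a≢a

    pairTerm-punchIn : ∀ X Y a b → pairTerm X Y a (punchIn a b) ≈
                       sign (toℕ a) * (X a * (sign (toℕ b) * (Y (punchIn a b) * cofactor₂ a b)))
    pairTerm-punchIn X Y a b with a ≟ punchIn a b
    ... | yes a≡ = contradiction (≡.sym a≡) (punchInᵢ≢i a b)
    ... | no a≢ = reflexive (≡.cong (λ b′ → sign (toℕ a) * (X a * (sign (toℕ b′) * (Y (punchIn a b) * cofactor₂ a b′))))
                                    (≡.trans (punchOut-cong a ≡.refl) (punchOut-punchIn a)))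

    expansion-pairs : ∀ X Y → expansion X Y ≈ ∑[ a < suc (suc m) ] ∑[ c < suc (suc m) ] pairTerm X Y a c
    expansion-pairs X Y = sum-cong λ a → begin
      sign (toℕ a) * (X a * ∑[ b < suc m ] F a b)        ≈⟨ *-congˡ (*-distribˡ-sum (X a) (F a)) ⟩
      sign (toℕ a) * ∑[ b < suc m ] (X a * F a b)        ≈⟨ *-distribˡ-sum (sign (toℕ a)) (λ b → X a * F a b) ⟩
      ∑[ b < suc m ] (sign (toℕ a) * (X a * F a b))      ≈⟨ sum-cong (λ b → sym (pairTerm-punchIn X Y a b)) ⟩
      ∑[ b < suc m ] pairTerm X Y a (punchIn a b)        ≈⟨ +-identityˡ _ ⟨
      0# + ∑[ b < suc m ] pairTerm X Y a (punchIn a b)   ≈⟨ +-congʳ (pairTerm-diagonal X Y a) ⟨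
      pairTerm X Y a a + ∑[ b < suc m ] pairTerm X Y a (punchIn a b) ≈⟨ sum-remove (pairTerm X Y a) ⟨
      ∑[ c < suc (suc m) ] pairTerm X Y a c              ∎
      where
      F : Fin (suc (suc m)) → Fin (suc m) → Carrier
      F a b = sign (toℕ b) * (Y (punchIn a b) * cofactor₂ a b)

    pairTerm-antisymmetric : ∀ X Y a c → pairTerm Y X a c ≈ - pairTerm X Y c a
    pairTerm-antisymmetric X Y a c with a ≟ c | c ≟ a
    ... | yes _   | yes _   = sym -0#≈0#
    ... | yes a≡c | no c≢a = contradiction (≡.sym a≡c) c≢a
    ... | no a≢c  | yes c≡a = contradiction (≡.sym c≡a) a≢c
    ... | no a≢c  | no c≢a = begin
      sa * (y * (sp * (x * d₁)))
        ≈⟨ solve 5 (λ sa y sp x d → sa ⊕ (y ⊕ (sp ⊕ (x ⊕ d))) ⊜ (sa ⊕ sp) ⊕ (y ⊕ (x ⊕ d))) refl sa y sp x d₁ ⟩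
      (sa * sp) * (y * (x * d₁))
        ≈⟨ *-cong (sign-punchOut a≢c c≢a) (*-congˡ (*-congˡ d₁≈d₂)) ⟩
      - (sc * sq) * (y * (x * d₂))
        ≈⟨ -‿distribˡ-* _ _ ⟨
      - ((sc * sq) * (y * (x * d₂)))
        ≈⟨ -‿cong (solve 5 (λ sc sq y x d → (sc ⊕ sq) ⊕ (y ⊕ (x ⊕ d)) ⊜ sc ⊕ (x ⊕ (sq ⊕ (y ⊕ d)))) refl sc sq y x d₂) ⟩
      - (sc * (x * (sq * (y * d₂)))) ∎
      where
      sa = sign (toℕ a)
      sc = sign (toℕ c)
      sp = sign (toℕ (punchOut a≢c))
      sq = sign (toℕ (punchOut c≢a))
      x  = X c
      y  = Y a
      d₁ = cofactor₂ a (punchOut a≢c)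
      d₂ = cofactor₂ c (punchOut c≢a)
      d₁≈d₂ : d₁ ≈ d₂
      d₁≈d₂ = det-cong m (λ i k → reflexive (≡.cong (M (suc (suc i))) (punchIn-punchOut-swap a≢c c≢a k)))

    expansion-antisymmetric : ∀ X Y → expansion Y X ≈ - expansion X Y
    expansion-antisymmetric X Y = begin
      expansion Y X                                   ≈⟨ expansion-pairs Y X ⟩
      ∑[ a < N ] ∑[ c < N ] pairTerm Y X a c          ≈⟨ sum-cong (λ a → sum-cong (λ c → pairTerm-antisymmetric X Y a c)) ⟩
      ∑[ a < N ] ∑[ c < N ] (- pairTerm X Y c a)      ≈⟨ sum-cong (λ a → -‿distrib-sum (λ c → pairTerm X Y c a)) ⟨
      ∑[ a < N ] (- ∑[ c < N ] pairTerm X Y c a)      ≈⟨ -‿distrib-sum (λ a → ∑[ c < N ] pairTerm X Y c a) ⟨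
      - ∑[ a < N ] ∑[ c < N ] pairTerm X Y c a        ≈⟨ -‿cong (∑-comm (λ a c → pairTerm X Y c a)) ⟩
      - ∑[ c < N ] ∑[ a < N ] pairTerm X Y c a        ≈⟨ -‿cong (expansion-pairs X Y) ⟨
      - expansion X Y                                 ∎
      where N = suc (suc m)

  det-swapRows₀₁ : ∀ {n} (M : Matrix (suc (suc n))) → det (suc (suc n)) (swapRows₀₁ M) ≈ - det (suc (suc n)) M
  det-swapRows₀₁ M = expansion-antisymmetric (M zero) (M (suc zero))
    where open DoubleExpansion M

  addRow₀Multiples : ∀ {n} → Carrier → Matrix (suc n) → Matrix (suc n)
  addRow₀Multiples x M zero    j = M zero j
  addRow₀Multiples x M (suc t) j = x * M zero j + M (suc t) j

  TwoTorsionFree : Set (c ⊔ ℓ)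
  TwoTorsionFree = ∀ x → x + x ≈ 0# → x ≈ 0#

  module _ (x+x≈0⇒x≈0 : TwoTorsionFree) where

    det-row₀-repeated : ∀ n (M : Matrix (suc n)) t → (∀ j → M (suc t) j ≈ M zero j) → det (suc n) M ≈ 0#
    det-row₀-repeated (suc n) M zero rows≈ = x+x≈0⇒x≈0 _ (begin
      det N M + det N M                 ≈⟨ +-congˡ (det-cong N swapped≈) ⟨
      det N M + det N (swapRows₀₁ M)    ≈⟨ +-congˡ (det-swapRows₀₁ M) ⟩
      det N M + - det N M               ≈⟨ -‿inverseʳ _ ⟩
      0#                                ∎)
      where
      N = suc (suc n)
      swapped≈ : ∀ i j → swapRows₀₁ M i j ≈ M i j
      swapped≈ zero          j = rows≈ j
      swapped≈ (suc zero)    j = sym (rows≈ j)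
      swapped≈ (suc (suc i)) j = refl
    det-row₀-repeated (suc n) M (suc t) rows≈ = begin
      det N M                           ≈⟨ -‿involutive _ ⟨
      - - det N M                       ≈⟨ -‿cong (det-swapRows₀₁ M) ⟨
      - det N (swapRows₀₁ M)            ≈⟨ -‿cong (sum-zero {f = laplaceTerm (swapRows₀₁ M)} λ j →
                                             trans (*-congˡ (*-congˡ (minor-zero j))) (trans (*-congˡ (zeroʳ _)) (zeroʳ _))) ⟩
      - 0#                              ≈⟨ -0#≈0# ⟩
      0#                                ∎
      where
      N = suc (suc n)
      minor-zero : ∀ j → det (suc n) (minor (swapRows₀₁ M) j) ≈ 0#
      minor-zero j = det-row₀-repeated n (minor (swapRows₀₁ M) j) t (λ k → rows≈ (punchIn j k))

    det-withRow₀-columnSums : ∀ n (M : Matrix (suc n)) →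
                              det (suc n) (withRow₀ M (λ j → ∑[ i < suc n ] M i j)) ≈ det (suc n) M
    det-withRow₀-columnSums n M = begin
      det (suc n) (withRow₀ M (λ j → ∑[ i < suc n ] M i j))  ≈⟨ det-withRow₀-sum M M ⟩
      det (suc n) M + ∑[ t < n ] det (suc n) (withRow₀ M (M (suc t)))
        ≈⟨ +-congˡ (sum-zero (λ t → det-row₀-repeated n (withRow₀ M (M (suc t))) t (λ _ → refl))) ⟩
      det (suc n) M + 0#                                     ≈⟨ +-identityʳ _ ⟩
      det (suc n) M                                          ∎

    det-add-row₀-multiple : ∀ n {M M′ : Matrix (suc n)} t x →
                            (∀ j → M′ (suc t) j ≈ x * M zero j + M (suc t) j) →
                            (∀ i → i ≡.≢ suc t → ∀ j → M′ i j ≈ M i j) →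
                            det (suc n) M′ ≈ det (suc n) M
    det-add-row₀-multiple n {M} {M′} t x row others = begin
      det (suc n) M′                   ≈⟨ det-linear n (suc t) x row′ others′ ⟩
      x * det (suc n) N + det (suc n) M ≈⟨ +-congʳ (*-congˡ (det-row₀-repeated n N t N-rows)) ⟩
      x * 0# + det (suc n) M            ≈⟨ +-congʳ (zeroʳ x) ⟩
      0# + det (suc n) M                ≈⟨ +-identityˡ _ ⟩
      det (suc n) M                     ∎
      where
      N : Matrix (suc n)
      N = updateAt M (suc t) (λ _ → M zero)
      N-rows : ∀ j → N (suc t) j ≈ N zero j
      N-rows j = reflexive (≡.cong (_$ j) (updateAt-updates (suc t) M))
      row′ : ∀ j → M′ (suc t) j ≈ x * N (suc t) j + M (suc t) j
      row′ j = trans (row j) (reflexive (≡.cong (λ r → x * r j + M (suc t) j) (≡.sym (updateAt-updates (suc t) M))))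
      others′ : ∀ i → i ≡.≢ suc t → ∀ j → M′ i j ≈ N i j × M′ i j ≈ M i j
      others′ i i≢ j = trans (others i i≢ j) (reflexive (≡.cong (_$ j) (≡.sym (updateAt-minimal i (suc t) M i≢)))) , others i i≢ j

    module _ {n} (x : Carrier) (M : Matrix (suc n)) where
      private
        addedIf : ∀ {A : Set} → Dec A → Fin n → Fin (suc n) → Carrier
        addedIf (yes _) t j = x * M zero j + M (suc t) j
        addedIf (no _)  t j = M (suc t) j

        addedBelow : ℕ → Matrix (suc n)
        addedBelow k zero    = M zero
        addedBelow k (suc t) = addedIf (toℕ t ℕ.<? k) t

        addedBelow-zero : ∀ i j → addedBelow 0 i j ≈ M i j
        addedBelow-zero zero    j = refl
        addedBelow-zero (suc t) j with toℕ t ℕ.<? 0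
        ... | no _ = refl

        addedBelow-all : ∀ i j → addedBelow n i j ≈ addRow₀Multiples x M i j
        addedBelow-all zero    j = refl
        addedBelow-all (suc t) j with toℕ t ℕ.<? n
        ... | yes _     = refl
        ... | no t≮n = contradiction (toℕ<n t) t≮n

        det-addedBelow-suc : ∀ k (k<n : k ℕ.< n) → det (suc n) (addedBelow (suc k)) ≈ det (suc n) (addedBelow k)
        det-addedBelow-suc k k<n = det-add-row₀-multiple n tₖ x row others
          where
          tₖ = fromℕ< k<n
          tₖ≡k : toℕ tₖ ≡.≡ k
          tₖ≡k = toℕ-fromℕ< k<n
          row : ∀ j → addedBelow (suc k) (suc tₖ) j ≈ x * M zero j + addedBelow k (suc tₖ) j
          row j with toℕ tₖ ℕ.<? suc k | toℕ tₖ ℕ.<? k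
          ... | yes _   | no _  = refl
          ... | no tₖ≮ | _     = contradiction (ℕ.s≤s (ℕ.≤-reflexive tₖ≡k)) tₖ≮
          ... | yes _   | yes tₖ< = contradiction (≡.subst (ℕ._< k) tₖ≡k tₖ<) (ℕ.<-irrefl ≡.refl)
          others : ∀ i → i ≡.≢ suc tₖ → ∀ j → addedBelow (suc k) i j ≈ addedBelow k i j
          others zero    _ j = refl
          others (suc t) t≢ j with toℕ t ℕ.<? suc k | toℕ t ℕ.<? k
          ... | yes _  | yes _  = refl
          ... | no _   | no _   = refl
          ... | no t≮  | yes t< = contradiction (ℕ.m<n⇒m<1+n t<) t≮
          ... | yes t< | no t≮  = contradiction (≡.cong suc (toℕ-injective (≡.trans t≡k (≡.sym tₖ≡k)))) t≢
            where t≡k = ℕ.≤-antisym (ℕ.s≤s⁻¹ t<) (ℕ.≮⇒≥ t≮)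

        det-addedBelow : ∀ k → k ℕ.≤ n → det (suc n) (addedBelow k) ≈ det (suc n) M
        det-addedBelow zero    _   = det-cong (suc n) addedBelow-zero
        det-addedBelow (suc k) k<n = trans (det-addedBelow-suc k k<n) (det-addedBelow k (ℕ.<⇒≤ k<n))

      det-addRow₀Multiples : det (suc n) (addRow₀Multiples x M) ≈ det (suc n) M
      det-addRow₀Multiples = trans (sym (det-cong (suc n) addedBelow-all)) (det-addedBelow n ℕ.≤-refl)

module LeftCirculant {c ℓ} (R : CommutativeRing c ℓ) (x+x≈0⇒x≈0 : Determinant.TwoTorsionFree R) where
  open CommutativeRing R hiding (zero)
  open FiniteSums R
  open Determinant R
  import Data.Nat as ℕ
  open import Function.Base using (_∘_)
  open import Data.Fin using (Fin; zero; suc; toℕ)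
  import Relation.Binary.PropositionalEquality as ≡
  open import Relation.Binary.Reasoning.Setoid setoid

  leftCirculant : ∀ m → (ℕ → Carrier) → Matrix (suc m)
  leftCirculant m a i j = a ((toℕ i ℕ.+ toℕ j) ℕ.% suc m)

  leftCirculant-columnSum : ∀ m a j → ∑[ i < suc m ] leftCirculant m a i j ≈ ∑[ l < suc m ] a (toℕ l)
  leftCirculant-columnSum m a j = begin
    ∑[ i < suc m ] leftCirculant m a i j ≈⟨ reflexive (sum-cong-≗ λ i → ≡.cong a (≡.sym (toℕ-⊕ i j))) ⟩
    ∑[ i < suc m ] a (toℕ (i ⊕ j))       ≈⟨ sum-reindex (_⊕ j) (⊕-cancelʳ j) (a ∘ toℕ) ⟩
    ∑[ l < suc m ] a (toℕ l)             ∎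
    where open Modular (suc m)

  det-leftCirculant : ∀ m a → det (suc m) (leftCirculant m a) ≈
                      (∑[ l < suc m ] a (toℕ l)) * det (suc m) (withRow₀ (leftCirculant m a) (λ _ → 1#))
  det-leftCirculant m a = begin
    det (suc m) M                                          ≈⟨ det-withRow₀-columnSums x+x≈0⇒x≈0 m M ⟨
    det (suc m) (withRow₀ M (λ j → ∑[ i < suc m ] M i j))  ≈⟨ det-cong (suc m) columnSums≈ ⟩
    det (suc m) (withRow₀ M (λ _ → S))                     ≈⟨ det-withRow₀-constant M S ⟩
    S * det (suc m) (withRow₀ M (λ _ → 1#))                ∎
    where
    M = leftCirculant m a
    S = ∑[ l < suc m ] a (toℕ l)
    columnSums≈ : ∀ i j → withRow₀ M (λ j → ∑[ i < suc m ] M i j) i j ≈ withRow₀ M (λ _ → S) i j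
    columnSums≈ zero    j = leftCirculant-columnSum m a j
    columnSums≈ (suc i) j = refl

  det-withRow₀-ones-shift : ∀ m a x →
    det (suc m) (withRow₀ (leftCirculant m (λ l → a l + x)) (λ _ → 1#)) ≈
    det (suc m) (withRow₀ (leftCirculant m a) (λ _ → 1#))
  det-withRow₀-ones-shift m a x = trans (det-cong (suc m) shifted≈)
    (det-addRow₀Multiples x+x≈0⇒x≈0 x (withRow₀ (leftCirculant m a) (λ _ → 1#)))
    where
    shifted≈ : ∀ i j → withRow₀ (leftCirculant m (λ l → a l + x)) (λ _ → 1#) i j ≈
                       addRow₀Multiples x (withRow₀ (leftCirculant m a) (λ _ → 1#)) i j
    shifted≈ zero    j = refl
    shifted≈ (suc i) j = trans (+-comm _ x) (+-congʳ (sym (*-identityʳ x)))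

module GroupRing (p′ : ℕ) where
  import Data.Nat as ℕ
  open import Data.Nat using (_+_; _%_; _≟_)
  import Data.Nat.Properties as ℕ
  open import Data.Nat.DivMod using (_mod_)
  open import Level using (0ℓ)
  open import Algebra.Structures using (IsCommutativeRing)
  import Algebra.Construct.Pointwise as Pointwise
  open import Data.Integer as ℤ using (ℤ)
  import Data.Integer.Properties as ℤ
  open import Data.Fin using (Fin; zero; suc; toℕ; punchIn)
  open import Data.Fin.Properties using (punchInᵢ≢i)
  open import Data.Product using (∃; _,_; proj₁; proj₂)
  import Data.Vec.Functional as Vector
  open import Relation.Binary.PropositionalEquality
  open import Relation.Nullary using (yes; no; contradiction)
  open import Data.Integer.Tactic.RingSolver using (solve-∀)

  p : ℕ
  p = suc p′

  open Cyc p
  open Modular p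
  module ℤΣ = FiniteSums ℤ.+-*-commutativeRing

  infix 4 _≗R_
  _≗R_ : R → R → Set
  f ≗R g = ∀ k → f k ≡ g k

  sumFin≡foldr : ∀ {A : Set} (z : A) _∙_ n (f : Fin n → A) → sumFin z _∙_ n f ≡ Vector.foldr _∙_ z f
  sumFin≡foldr z _∙_ zero    f = refl
  sumFin≡foldr z _∙_ (suc n) f = cong (f zero ∙_) (sumFin≡foldr z _∙_ n (λ i → f (suc i)))

  *R-convolution : ∀ f g k → (f *R g) k ≡ ℤΣ.∑[ i < p ] (f i ℤ.* g (k ⊖ i))
  *R-convolution f g k = sumFin≡foldr ℤ.0ℤ ℤ._+_ p (λ i → f i ℤ.* g (k ⊖ i))

  *R-comm : ∀ f g → f *R g ≗R g *R f
  *R-comm f g k = begin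
    (f *R g) k                             ≡⟨ *R-convolution f g k ⟩
    ℤΣ.∑[ i < p ] (f i ℤ.* g (k ⊖ i))      ≡⟨ ℤΣ.sum-cong-≗ swap ⟩
    ℤΣ.∑[ i < p ] F (k ⊖ i)                ≡⟨ ℤΣ.sum-reindex (k ⊖_) (⊖-cancelˡ k) F ⟩
    ℤΣ.∑[ j < p ] F j                      ≡⟨ *R-convolution g f k ⟨
    (g *R f) k                             ∎
    where
    open ≡-Reasoning
    F : Fin p → ℤ
    F j = g j ℤ.* f (k ⊖ j)
    swap : ∀ i → f i ℤ.* g (k ⊖ i) ≡ F (k ⊖ i)
    swap i = trans (ℤ.*-comm (f i) (g (k ⊖ i))) (cong (λ j → g (k ⊖ i) ℤ.* f j) (sym (⊖-involutive k i)))

  *R-assoc : ∀ f g h → (f *R g) *R h ≗R f *R (g *R h)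
  *R-assoc f g h k = begin
    ((f *R g) *R h) k
      ≡⟨ *R-convolution (f *R g) h k ⟩
    ℤΣ.∑[ i < p ] ((f *R g) i ℤ.* h (k ⊖ i))
      ≡⟨ ℤΣ.sum-cong-≗ (λ i → trans (cong (ℤ._* h (k ⊖ i)) (*R-convolution f g i))
                                    (ℤΣ.*-distribʳ-sum (h (k ⊖ i)) (λ j → f j ℤ.* g (i ⊖ j)))) ⟩
    ℤΣ.∑[ i < p ] ℤΣ.∑[ j < p ] (f j ℤ.* g (i ⊖ j) ℤ.* h (k ⊖ i))
      ≡⟨ ℤΣ.∑-comm (λ i j → f j ℤ.* g (i ⊖ j) ℤ.* h (k ⊖ i)) ⟩
    ℤΣ.∑[ j < p ] ℤΣ.∑[ i < p ] (f j ℤ.* g (i ⊖ j) ℤ.* h (k ⊖ i))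
      ≡⟨ ℤΣ.sum-cong-≗ (λ j → trans (ℤΣ.sum-cong-≗ (λ i → ℤ.*-assoc (f j) (g (i ⊖ j)) (h (k ⊖ i))))
                                    (sym (ℤΣ.*-distribˡ-sum (f j) (λ i → g (i ⊖ j) ℤ.* h (k ⊖ i))))) ⟩
    ℤΣ.∑[ j < p ] (f j ℤ.* ℤΣ.∑[ i < p ] (g (i ⊖ j) ℤ.* h (k ⊖ i)))
      ≡⟨ ℤΣ.sum-cong-≗ (λ j → cong (f j ℤ.*_) (inner j)) ⟩
    ℤΣ.∑[ j < p ] (f j ℤ.* (g *R h) (k ⊖ j))
      ≡⟨ *R-convolution f (g *R h) k ⟨
    (f *R (g *R h)) k ∎
    where
    open ≡-Reasoning
    inner : ∀ j → ℤΣ.∑[ i < p ] (g (i ⊖ j) ℤ.* h (k ⊖ i)) ≡ (g *R h) (k ⊖ j)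
    inner j = begin
      ℤΣ.∑[ i < p ] (g (i ⊖ j) ℤ.* h (k ⊖ i))
        ≡⟨ ℤΣ.sum-cong-≗ (λ i → cong (λ l → g (i ⊖ j) ℤ.* h l) (sym (⊖-⊖ k i j))) ⟩
      ℤΣ.∑[ i < p ] (g (i ⊖ j) ℤ.* h ((k ⊖ j) ⊖ (i ⊖ j)))
        ≡⟨ ℤΣ.sum-reindex (_⊖ j) (⊖-cancelʳ j) (λ l → g l ℤ.* h ((k ⊖ j) ⊖ l)) ⟩
      ℤΣ.∑[ l < p ] (g l ℤ.* h ((k ⊖ j) ⊖ l))
        ≡⟨ *R-convolution g h (k ⊖ j) ⟨
      (g *R h) (k ⊖ j) ∎

  *R-identityˡ : ∀ g → 1R *R g ≗R g
  *R-identityˡ g k = begin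
    (1R *R g) k
      ≡⟨ *R-convolution 1R g k ⟩
    ℤ.1ℤ ℤ.* g (k ⊖ zero) ℤ.+ ℤΣ.∑[ i < p′ ] (ℤ.0ℤ ℤ.* g (k ⊖ suc i))
      ≡⟨ cong₂ ℤ._+_ (ℤ.*-identityˡ (g (k ⊖ zero))) (ℤΣ.sum-zero (λ i → ℤ.*-zeroˡ (g (k ⊖ suc i)))) ⟩
    g (k ⊖ zero) ℤ.+ ℤ.0ℤ
      ≡⟨ ℤ.+-identityʳ (g (k ⊖ zero)) ⟩
    g (k ⊖ zero)
      ≡⟨ cong g (⊖-identityʳ k) ⟩
    g k ∎
    where open ≡-Reasoning

  *R-distribˡ : ∀ f g h → f *R (g +R h) ≗R (f *R g) +R (f *R h)
  *R-distribˡ f g h k = begin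
    (f *R (g +R h)) k
      ≡⟨ *R-convolution f (g +R h) k ⟩
    ℤΣ.∑[ i < p ] (f i ℤ.* (g (k ⊖ i) ℤ.+ h (k ⊖ i)))
      ≡⟨ ℤΣ.sum-cong-≗ (λ i → ℤ.*-distribˡ-+ (f i) (g (k ⊖ i)) (h (k ⊖ i))) ⟩
    ℤΣ.∑[ i < p ] (f i ℤ.* g (k ⊖ i) ℤ.+ f i ℤ.* h (k ⊖ i))
      ≡⟨ ℤΣ.∑-distrib-+ (λ i → f i ℤ.* g (k ⊖ i)) (λ i → f i ℤ.* h (k ⊖ i)) ⟩
    ℤΣ.∑[ i < p ] (f i ℤ.* g (k ⊖ i)) ℤ.+ ℤΣ.∑[ i < p ] (f i ℤ.* h (k ⊖ i))
      ≡⟨ cong₂ ℤ._+_ (*R-convolution f g k) (*R-convolution f h k) ⟨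
    ((f *R g) +R (f *R h)) k ∎
    where open ≡-Reasoning

  *R-cong : ∀ {f f′ g g′} → f ≗R f′ → g ≗R g′ → f *R g ≗R f′ *R g′
  *R-cong {f} {f′} {g} {g′} f≗ g≗ k = begin
    (f *R g) k                            ≡⟨ *R-convolution f g k ⟩
    ℤΣ.∑[ i < p ] (f i ℤ.* g (k ⊖ i))     ≡⟨ ℤΣ.sum-cong-≗ (λ i → cong₂ ℤ._*_ (f≗ i) (g≗ (k ⊖ i))) ⟩
    ℤΣ.∑[ i < p ] (f′ i ℤ.* g′ (k ⊖ i))   ≡⟨ *R-convolution f′ g′ k ⟨
    (f′ *R g′) k                          ∎
    where open ≡-Reasoning

  isCommutativeRing : IsCommutativeRing _≗R_ _+R_ _*R_ -R_ 0R 1R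
  isCommutativeRing = record
    { isRing = record
      { +-isAbelianGroup = Pointwise.isAbelianGroup (Fin p) ℤ.+-0-isAbelianGroup
      ; *-cong     = *R-cong
      ; *-assoc    = *R-assoc
      ; *-identity = *R-identityˡ , λ g k → trans (*R-comm g 1R k) (*R-identityˡ g k)
      ; distrib    = *R-distribˡ , λ f g h k → trans (*R-comm (g +R h) f k)
                       (trans (*R-distribˡ f g h k) (cong₂ ℤ._+_ (*R-comm f g k) (*R-comm f h k)))
      }
    ; *-comm = *R-comm
    }

  ring : CommutativeRing 0ℓ 0ℓ
  ring = record { isCommutativeRing = isCommutativeRing }

  module RDet = Determinant ring

  -- Cyc.det keeps its sign function local to a where block: unification exposes the summands
  -- of its expansion, and abstracting over toℕ j lets the sign reduce.
  cyc-det-unfold : ∀ n (M : Fin (suc n) → Fin (suc n) → R) → ∃ λ (G : Fin n → R) →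
                   det (suc n) M ≡ (1R *R (M zero zero *R det n (RDet.minor M zero))) +R sumR n G
  cyc-det-unfold n M = _ , refl

  mutual
    cyc-det-summand : ∀ n M j → proj₁ (cyc-det-unfold n M) j ≡
                      RDet.sign (suc (toℕ j)) *R (M zero (suc j) *R det n (RDet.minor M (suc j)))
    cyc-det-summand n M j with toℕ j
    ... | m = sign-agrees n M j m

    sign-agrees : ∀ n (M : Fin (suc n) → Fin (suc n) → R) (j : Fin n) (m : ℕ) → _
    sign-agrees n M j zero          = refl
    sign-agrees n M j (suc zero)    = refl
    sign-agrees n M j (suc (suc m)) = sign-agrees n M j m

  module RΣ = FiniteSums ring

  det≗RDet : ∀ n M → det n M ≗R RDet.det n M
  det≗RDet zero    M k = refl
  det≗RDet (suc n) M = begin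
    det (suc n) M
      ≡⟨ proj₂ (cyc-det-unfold n M) ⟩
    (1R *R (M zero zero *R det n m₀)) +R sumR n G
      ≡⟨ cong ((1R *R (M zero zero *R det n m₀)) +R_) (sumFin≡foldr 0R _+R_ n G) ⟩
    (1R *R (M zero zero *R det n m₀)) +R RΣ.sum G
      ≈⟨ +R-cong (scale 1R (M zero zero) (det≗RDet n m₀)) (RΣ.sum-cong summands) ⟩
    RDet.det (suc n) M ∎
    where
    open import Relation.Binary.Reasoning.Setoid (CommutativeRing.setoid ring)
    m₀ = RDet.minor M zero
    G = proj₁ (cyc-det-unfold n M)
    +R-cong = CommutativeRing.+-cong ring
    scale : ∀ a b {x y} → x ≗R y → a *R (b *R x) ≗R a *R (b *R y)
    scale a b {x} {y} x≗y = *R-cong {a} {a} {b *R x} {b *R y} (λ _ → refl) (*R-cong {b} {b} {x} {y} (λ _ → refl) x≗y)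
    summands : ∀ j → G j ≗R RDet.sign (suc (toℕ j)) *R (M zero (suc j) *R RDet.det n (RDet.minor M (suc j)))
    summands j k = trans (cong (λ F → F k) (cyc-det-summand n M j))
                         (scale (RDet.sign (suc (toℕ j))) (M zero (suc j)) (det≗RDet n (RDet.minor M (suc j))) k)

  sum-apply : ∀ {n} (F : Fin n → R) k → RΣ.sum F k ≡ ℤΣ.∑[ i < n ] F i k
  sum-apply {zero}  F k = refl
  sum-apply {suc n} F k = cong (λ S → F zero k ℤ.+ S) (sum-apply (λ i → F (suc i)) k)

  sumR-apply : ∀ n (F : Fin n → R) k → sumR n F k ≡ ℤΣ.∑[ i < n ] F i k
  sumR-apply n F k = trans (cong (λ S → S k) (sumFin≡foldr 0R _+R_ n F)) (sum-apply F k)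

  x+x≗0⇒x≗0 : ∀ f → f +R f ≗R 0R → f ≗R 0R
  x+x≗0⇒x≗0 f f+f≗0 k = i+i≡0⇒i≡0 (f k) (f+f≗0 k)
    where
    i+i≡0⇒i≡0 : ∀ i → i ℤ.+ i ≡ ℤ.0ℤ → i ≡ ℤ.0ℤ
    i+i≡0⇒i≡0 (ℤ.+ zero) _ = refl

  ∑-const : ∀ n m → ℤΣ.∑[ i < n ] (ℤ.+ m) ≡ ℤ.+ (n ℕ.* m)
  ∑-const zero    m = refl
  ∑-const (suc n) m = cong (λ S → ℤ.+ m ℤ.+ S) (∑-const n m)

  -- flat z = z·(1 + ω + ⋯ + ω^(p-1)), which is 0 in ℤ[ω].
  flat : ℤ → R
  flat z _ = z

  flat-*R : ∀ z f → flat z *R f ≗R flat (z ℤ.* ℤΣ.sum f)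
  flat-*R z f k = begin
    (flat z *R f) k                    ≡⟨ *R-convolution (flat z) f k ⟩
    ℤΣ.∑[ i < p ] (z ℤ.* f (k ⊖ i))    ≡⟨ ℤΣ.*-distribˡ-sum z (λ i → f (k ⊖ i)) ⟨
    z ℤ.* ℤΣ.∑[ i < p ] f (k ⊖ i)      ≡⟨ cong (z ℤ.*_) (ℤΣ.sum-reindex (k ⊖_) (⊖-cancelˡ k) f) ⟩
    z ℤ.* ℤΣ.sum f                     ∎
    where open ≡-Reasoning

  ≈-modulo-flat : ∀ {f f′ h} a b → f ≗R flat a +R h → f′ ≗R flat b +R h → f ≈ f′
  ≈-modulo-flat {f} {f′} {h} a b f≗ f′≗ = a ℤ.- b , λ k → begin
    f k ℤ.- f′ k                    ≡⟨ cong₂ ℤ._-_ (f≗ k) (f′≗ k) ⟩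
    (a ℤ.+ h k) ℤ.- (b ℤ.+ h k)     ≡⟨ cancel a b (h k) ⟩
    a ℤ.- b                         ∎
    where
    open ≡-Reasoning
    cancel : ∀ a b c → (a ℤ.+ c) ℤ.- (b ℤ.+ c) ≡ a ℤ.- b
    cancel = solve-∀

  ωpow-≡1 : ∀ n t → toℕ t ≡ n % p → ωpow n t ≡ ℤ.1ℤ
  ωpow-≡1 n t t≡n with toℕ t ≟ n % p
  ... | yes _   = refl
  ... | no t≢n = contradiction t≡n t≢n

  ωpow-≡0 : ∀ n t → toℕ t ≢ n % p → ωpow n t ≡ ℤ.0ℤ
  ωpow-≡0 n t t≢n with toℕ t ≟ n % p
  ... | yes t≡n = contradiction t≡n t≢n
  ... | no _    = refl

  ωpow-cong : ∀ m n → m % p ≡ n % p → ∀ t → ωpow m t ≡ ωpow n t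
  ωpow-cong m n m≡n t with toℕ t ≟ m % p
  ... | yes t≡m = sym (ωpow-≡1 n t (trans t≡m m≡n))
  ... | no t≢m  = sym (ωpow-≡0 n t (λ t≡n → t≢m (trans t≡n (sym m≡n))))

  ωpow-zero : ∀ t → ωpow 0 t ≡ const ℤ.1ℤ t
  ωpow-zero zero    = ωpow-≡1 0 zero refl
  ωpow-zero (suc t) = ωpow-≡0 0 (suc t) (λ ())

  ∑-ωpow : ∀ t → ℤΣ.∑[ s < p ] ωpow (toℕ s) t ≡ ℤ.1ℤ
  ∑-ωpow t = begin
    ℤΣ.∑[ s < p ] ωpow (toℕ s) t
      ≡⟨ ℤΣ.sum-remove {i = t} (λ s → ωpow (toℕ s) t) ⟩
    ωpow (toℕ t) t ℤ.+ ℤΣ.∑[ s < p′ ] ωpow (toℕ (punchIn t s)) t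
      ≡⟨ cong₂ ℤ._+_ (ωpow-≡1 (toℕ t) t (sym (toℕ-% t))) (ℤΣ.sum-zero others) ⟩
    ℤ.1ℤ ℤ.+ ℤ.0ℤ
      ≡⟨⟩
    ℤ.1ℤ ∎
    where
    open ≡-Reasoning
    others : ∀ s → ωpow (toℕ (punchIn t s)) t ≡ ℤ.0ℤ
    others s = ωpow-≡0 (toℕ (punchIn t s)) t λ t≡ → punchInᵢ≢i t s (toℕ-%-injective (trans (sym t≡) (sym (toℕ-% t))))

  ∑-ωpow-shift : ∀ x t → ℤΣ.∑[ y < p ] ωpow (x + toℕ y) t ≡ ℤ.1ℤ
  ∑-ωpow-shift x t = begin
    ℤΣ.∑[ y < p ] ωpow (x + toℕ y) t
      ≡⟨ ℤΣ.sum-cong-≗ (λ y → ωpow-cong (x + toℕ y) (toℕ (y ⊕ x mod p)) (rotate y) t) ⟩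
    ℤΣ.∑[ y < p ] ωpow (toℕ (y ⊕ x mod p)) t
      ≡⟨ ℤΣ.sum-reindex (_⊕ x mod p) (⊕-cancelʳ (x mod p)) (λ s → ωpow (toℕ s) t) ⟩
    ℤΣ.∑[ s < p ] ωpow (toℕ s) t
      ≡⟨ ∑-ωpow t ⟩
    ℤ.1ℤ ∎
    where
    open ≡-Reasoning
    rotate : ∀ y → (x + toℕ y) % p ≡ toℕ (y ⊕ x mod p) % p
    rotate y = begin
      (x + toℕ y) % p                 ≡⟨ cong (_% p) (ℕ.+-comm x (toℕ y)) ⟩
      (toℕ y + x) % p                 ≡⟨ %-absorbʳ-+ (toℕ y) x ⟨
      (toℕ y + x % p) % p             ≡⟨ cong (λ z → (toℕ y + z) % p) (toℕ-mod x) ⟨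
      (toℕ y + toℕ (x mod p)) % p     ≡⟨ toℕ-⊕ y (x mod p) ⟨
      toℕ (y ⊕ x mod p)               ≡⟨ toℕ-% (y ⊕ x mod p) ⟨
      toℕ (y ⊕ x mod p) % p           ∎

  ∑-ωpow-nonzero : ∀ x t → ℤΣ.∑[ y < p′ ] ωpow (x + suc (toℕ y)) t ≡ ℤ.1ℤ ℤ.- ωpow x t
  ∑-ωpow-nonzero x t = begin
    S                                  ≡⟨ add-sub (ωpow x t) S ⟩
    (ωpow x t ℤ.+ S) ℤ.- ωpow x t       ≡⟨ cong (λ a → (ωpow a t ℤ.+ S) ℤ.- ωpow x t) (ℕ.+-identityʳ x) ⟨
    (ωpow (x + 0) t ℤ.+ S) ℤ.- ωpow x t ≡⟨ cong (ℤ._- ωpow x t) (∑-ωpow-shift x t) ⟩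
    ℤ.1ℤ ℤ.- ωpow x t                   ∎
    where
    open ≡-Reasoning
    S = ℤΣ.∑[ y < p′ ] ωpow (x + suc (toℕ y)) t
    add-sub : ∀ a b → b ≡ (a ℤ.+ b) ℤ.- a
    add-sub = solve-∀

module Division (p : ℕ) .{{_ : NonZero p}} (u x : ℕ) where
  open Cyc p using (divp)
  open import Data.Nat using (_*_; _%_; _<_; _≟_; >-nonZero⁻¹)
  open import Data.List using (List; []; _∷_; upTo)
  open import Data.List.Relation.Unary.Any using (Any; here; there)
  open import Data.List.Relation.Unary.All using (All; []; _∷_)
  open import Data.Product using (_×_; _,_; proj₁; proj₂)
  open import Relation.Binary.PropositionalEquality using (_≡_)
  open import Relation.Nullary using (yes; no; contradiction)

  Solves : ℕ → Set
  Solves y = (x * y) % p ≡ u % p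

  -- divp is a search local to Cyc; abstracting over upTo p exposes it on an arbitrary list.
  mutual
    divp-spec : (Any Solves (upTo p) → Solves (divp u x)) × (All (_< p) (upTo p) → divp u x < p)
    divp-spec with upTo p
    ... | ys = search-spec ys

    search-spec : (ys : List ℕ) → _
    search-spec []       = (λ ()) , λ _ → >-nonZero⁻¹ p
    search-spec (y ∷ ys) with (x * y) % p ≟ u % p
    ... | yes solves = (λ _ → solves) , λ { (y<p ∷ _) → y<p }
    ... | no ¬solves = (λ { (here s) → contradiction s ¬solves ; (there s) → proj₁ (search-spec ys) s })
                     , λ { (_ ∷ ys<p) → proj₂ (search-spec ys) ys<p }

module PrimeField (q : ℕ) (p-prime : Prime (suc (suc q))) where
  open import Data.Nat
  open import Data.Nat.Properties
  open import Data.Nat.DivMod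
  open import Data.Nat.Divisibility using (_∣_; m%n≡0⇒n∣m; n∣m⇒m%n≡0)
  open import Data.Nat.Primality using (euclidsLemma)
  open import Data.Fin using (Fin; toℕ)
  open import Data.Fin.Properties using (toℕ<n; toℕ-injective)
  open import Data.List.Membership.Propositional.Properties using (∈-upTo⁺; ∈-upTo⁻)
  open import Data.List.Relation.Unary.Any as Any using ()
  open import Data.List.Relation.Unary.All as All using ()
  open import Data.Product using (∃; _×_; _,_; proj₁; proj₂)
  open import Data.Sum using (inj₁; inj₂)
  open import Relation.Binary.PropositionalEquality
  open import Relation.Nullary using (¬_; contradiction)
  open FinProperties using (injective⇒surjective)

  p : ℕ
  p = suc (suc q)

  open Modular p using (%-cancelʳ-+; toℕ-mod)
  open Cyc p using (divp)

  ∣-bounded⇒≡0 : ∀ {d} → d < p → p ∣ d → d ≡ 0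
  ∣-bounded⇒≡0 {d} d<p p∣d = trans (sym (m<n⇒m%n≡m d<p)) (n∣m⇒m%n≡0 d p p∣d)

  p∣x*d⇒p∣d : ∀ {x d} → (x * d) % p ≡ 0 → ¬ p ∣ x → p ∣ d
  p∣x*d⇒p∣d {x} {d} x*d≡0 p∤x with euclidsLemma x d p-prime (m%n≡0⇒n∣m (x * d) p x*d≡0)
  ... | inj₁ p∣x = contradiction p∣x p∤x
  ... | inj₂ p∣d = p∣d

  private
    *-cancelˡ-%-≤ : ∀ {x a b} → ¬ p ∣ x → a ≤ b → b < p → (x * a) % p ≡ (x * b) % p → a ≡ b
    *-cancelˡ-%-≤ {x} {a} p∤x a≤b b<p eq with d , refl ← m≤n⇒∃[o]m+o≡n a≤b =
      sym (trans (cong (a +_) d≡0) (+-identityʳ a))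
      where
      x*d≡0 : (x * d) % p ≡ 0
      x*d≡0 = %-cancelʳ-+ (x * d) 0 (x * a) (begin
        (x * d + x * a) % p ≡⟨ cong (_% p) (trans (+-comm (x * d) (x * a)) (sym (*-distribˡ-+ x a d))) ⟩
        (x * (a + d)) % p   ≡⟨ eq ⟨
        (x * a) % p         ∎)
        where open ≡-Reasoning
      d≡0 : d ≡ 0
      d≡0 = ∣-bounded⇒≡0 (≤-<-trans (m≤n+m d a) b<p) (p∣x*d⇒p∣d x*d≡0 p∤x)

  *-cancelˡ-<p : ∀ {x y y′} → ¬ p ∣ x → y < p → y′ < p → (x * y) % p ≡ (x * y′) % p → y ≡ y′
  *-cancelˡ-<p {x} {y} {y′} p∤x y<p y′<p eq with ≤-total y y′
  ... | inj₁ y≤y′ = *-cancelˡ-%-≤ p∤x y≤y′ y′<p eq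
  ... | inj₂ y′≤y = sym (*-cancelˡ-%-≤ p∤x y′≤y y<p (sym eq))

  *-cancelˡ-% : ∀ {x y y′} → ¬ p ∣ x → (x * y) % p ≡ (x * y′) % p → y % p ≡ y′ % p
  *-cancelˡ-% {x} {y} {y′} p∤x eq = *-cancelˡ-<p p∤x (m%n<n y p) (m%n<n y′ p) (begin
    (x * (y % p)) % p   ≡⟨ reduce y ⟩
    (x * y) % p         ≡⟨ eq ⟩
    (x * y′) % p        ≡⟨ reduce y′ ⟨
    (x * (y′ % p)) % p  ∎)
    where
    open ≡-Reasoning
    reduce : ∀ z → (x * (z % p)) % p ≡ (x * z) % p
    reduce z = begin
      (x * (z % p)) % p             ≡⟨ %-distribˡ-* x (z % p) p ⟩
      ((x % p) * (z % p % p)) % p   ≡⟨ cong (λ w → ((x % p) * w) % p) (m%n%n≡m%n z p) ⟩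
      ((x % p) * (z % p)) % p       ≡⟨ %-distribˡ-* x z p ⟨
      (x * z) % p                   ∎

  *-surjective-% : ∀ {x} → ¬ p ∣ x → ∀ u → ∃ λ y → y < p × (x * y) % p ≡ u % p
  *-surjective-% {x} p∤x u = solution (injective⇒surjective τ-injective (u mod p))
    where
    τ : Fin p → Fin p
    τ y = (x * toℕ y) mod p
    τ-injective : ∀ {y y′} → τ y ≡ τ y′ → y ≡ y′
    τ-injective {y} {y′} e = toℕ-injective (*-cancelˡ-<p p∤x (toℕ<n y) (toℕ<n y′)
      (trans (sym (toℕ-mod (x * toℕ y))) (trans (cong toℕ e) (toℕ-mod (x * toℕ y′)))))
    solution : ∃ (λ y → τ y ≡ u mod p) → ∃ λ y → y < p × (x * y) % p ≡ u % p
    solution (y , τy≡u) = toℕ y , toℕ<n y , trans (sym (toℕ-mod (x * toℕ y))) (trans (cong toℕ τy≡u) (toℕ-mod u))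

  divp-correct : ∀ {x} → ¬ p ∣ x → ∀ u → (x * divp u x) % p ≡ u % p × divp u x < p
  divp-correct {x} p∤x u with y , y<p , xy≡u ← *-surjective-% p∤x u =
    proj₁ spec (Any.map (λ { refl → xy≡u }) (∈-upTo⁺ y<p)) , proj₂ spec (All.tabulate ∈-upTo⁻)
    where spec = Division.divp-spec p u x

module KloostermanSum (q : ℕ) (p-prime : Prime (suc (suc q))) (g : ℕ)
                      (g-primitive : IsPrimitiveRoot (suc (suc q)) g) where
  open import Data.Nat as ℕ using (_+_; _*_; _%_; _^_; _<_; _≤_; _∸_; z≤n; s≤s)
  open import Data.Nat.Properties as ℕ using ()
  open import Data.Nat.Divisibility using (_∣_; ∣1⇒≡1; n∣m⇒m%n≡0; m%n≡0⇒n∣m)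
  open import Function.Base using (_∘_)
  open import Data.Nat.Primality using (euclidsLemma)
  open import Data.Integer as ℤ using (ℤ)
  import Data.Integer.Properties as ℤ
  open import Data.Fin using (Fin; zero; suc; toℕ; fromℕ<)
  open import Data.Fin.Properties using (toℕ-fromℕ<; toℕ<n; toℕ-injective)
  open import Data.Product using (∃; _,_; proj₁; proj₂)
  open import Data.Sum using (inj₁; inj₂)
  open import Relation.Binary.PropositionalEquality
  open import Relation.Nullary using (¬_; contradiction)
  open PrimeField q p-prime
  open Cyc p
  open GroupRing (suc q) using (sumR-apply; ∑-const; ωpow-zero; ∑-ωpow-nonzero)
  module ℤΣ = FiniteSums ℤ.+-*-commutativeRing
  open import Data.Integer.Tactic.RingSolver using (solve-∀)

  p∤g^ : ∀ l → ¬ p ∣ g ^ l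
  p∤g^ zero    p∣1 with () ← ∣1⇒≡1 p∣1
  p∤g^ (suc l) p∣g^1+l with euclidsLemma g (g ^ l) p-prime p∣g^1+l
  ... | inj₁ p∣g   = proj₁ g-primitive (n∣m⇒m%n≡0 g p p∣g)
  ... | inj₂ p∣g^l = p∤g^ l p∣g^l

  private
    ^-injective-≤ : ∀ {l l′} → l ≤ l′ → l′ < p ∸ 1 → (g ^ l) % p ≡ (g ^ l′) % p → l ≡ l′
    ^-injective-≤ {l} l≤l′ l′<p-1 eq with ℕ.m≤n⇒∃[o]m+o≡n l≤l′
    ... | zero  , refl = sym (ℕ.+-identityʳ l)
    ... | suc k , refl = contradiction g^1+k≡1 (proj₂ g-primitive (suc k) (s≤s z≤n) (ℕ.≤-<-trans (ℕ.m≤n+m (suc k) l) l′<p-1))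
      where
      g^1+k≡1 : (g ^ suc k) % p ≡ 1
      g^1+k≡1 = *-cancelˡ-% (p∤g^ l) (begin
        (g ^ l * g ^ suc k) % p ≡⟨ cong (_% p) (ℕ.^-distribˡ-+-* g l (suc k)) ⟨
        (g ^ (l + suc k)) % p   ≡⟨ eq ⟨
        (g ^ l) % p             ≡⟨ cong (_% p) (ℕ.*-identityʳ (g ^ l)) ⟨
        (g ^ l * 1) % p         ∎)
        where open ≡-Reasoning

  ^-injective : ∀ {l l′} → l < p ∸ 1 → l′ < p ∸ 1 → (g ^ l) % p ≡ (g ^ l′) % p → l ≡ l′
  ^-injective {l} {l′} l<p-1 l′<p-1 eq with ℕ.≤-total l l′
  ... | inj₁ l≤l′ = ^-injective-≤ l≤l′ l′<p-1 eq
  ... | inj₂ l′≤l = sym (^-injective-≤ l′≤l l<p-1 (sym eq))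

  module Inverses (i : Fin (suc q)) where
    x : ℕ
    x = suc (toℕ i)

    p∤x : ¬ p ∣ x
    p∤x p∣x with () ← ∣-bounded⇒≡0 (s≤s (toℕ<n i)) p∣x

    quotient : Fin (suc q) → ℕ
    quotient l = divp (g ^ toℕ l) x

    quotient≢0 : ∀ l → quotient l ≢ 0
    quotient≢0 l q≡0 = p∤g^ (toℕ l) (m%n≡0⇒n∣m (g ^ toℕ l) p (begin
      (g ^ toℕ l) % p       ≡⟨ proj₁ (divp-correct p∤x (g ^ toℕ l)) ⟨
      (x * quotient l) % p  ≡⟨ cong (λ d → (x * d) % p) q≡0 ⟩
      (x * 0) % p           ≡⟨ cong (_% p) (ℕ.*-zeroʳ x) ⟩
      0                     ∎))
      where open ≡-Reasoning

    private
      nonzero⇒suc : ∀ d → d ≢ 0 → d < p → ∃ λ (y : Fin (suc q)) → suc (toℕ y) ≡ d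
      nonzero⇒suc zero    d≢0 _         = contradiction refl d≢0
      nonzero⇒suc (suc d) _   (s≤s d<p) = fromℕ< d<p , cong suc (toℕ-fromℕ< d<p)

      quotient-pred : ∀ l → ∃ λ (y : Fin (suc q)) → suc (toℕ y) ≡ quotient l
      quotient-pred l = nonzero⇒suc (quotient l) (quotient≢0 l) (proj₂ (divp-correct p∤x (g ^ toℕ l)))

    σ : Fin (suc q) → Fin (suc q)
    σ l = proj₁ (quotient-pred l)

    suc-σ : ∀ l → suc (toℕ (σ l)) ≡ quotient l
    suc-σ l = proj₂ (quotient-pred l)

    σ-injective : ∀ {l l′} → σ l ≡ σ l′ → l ≡ l′
    σ-injective {l} {l′} σl≡σl′ = toℕ-injective (^-injective (toℕ<n l) (toℕ<n l′) (begin
      (g ^ toℕ l) % p        ≡⟨ proj₁ (divp-correct p∤x (g ^ toℕ l)) ⟨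
      (x * quotient l) % p   ≡⟨ cong (λ d → (x * d) % p) quotient≡ ⟩
      (x * quotient l′) % p  ≡⟨ proj₁ (divp-correct p∤x (g ^ toℕ l′)) ⟩
      (g ^ toℕ l′) % p       ∎))
      where
      open ≡-Reasoning
      quotient≡ : quotient l ≡ quotient l′
      quotient≡ = trans (sym (suc-σ l)) (trans (cong (suc ∘ toℕ) σl≡σl′) (suc-σ l′))

    ∑-ωpow-quotients : ∀ t → ℤΣ.∑[ l < suc q ] ωpow (x + quotient l) t ≡ ℤ.1ℤ ℤ.- ωpow x t
    ∑-ωpow-quotients t = begin
      ℤΣ.∑[ l < suc q ] ωpow (x + quotient l) t         ≡⟨ ℤΣ.sum-cong-≗ (λ l → cong (λ d → ωpow (x + d) t) (sym (suc-σ l))) ⟩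
      ℤΣ.∑[ l < suc q ] ωpow (x + suc (toℕ (σ l))) t    ≡⟨ ℤΣ.sum-reindex σ σ-injective (λ y → ωpow (x + suc (toℕ y)) t) ⟩
      ℤΣ.∑[ y < suc q ] ωpow (x + suc (toℕ y)) t        ≡⟨ ∑-ωpow-nonzero x t ⟩
      ℤ.1ℤ ℤ.- ωpow x t                                  ∎
      where open ≡-Reasoning

  -- Σ_u K(u) = Σ_{x≠0} ω^x Σ_{y≠0} ω^y = Σ_{x≠0} ω^x (J - 1) = (p - 2) J + 1,  where J = 1 + ω + ⋯ + ω^(p-1).
  ∑-Kl : ∀ t → ℤΣ.∑[ l < suc q ] Kl (g ^ toℕ l) t ≡ ℤ.+ q ℤ.+ const ℤ.1ℤ t
  ∑-Kl t = begin
    ℤΣ.∑[ l < suc q ] Kl (g ^ toℕ l) t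
      ≡⟨ ℤΣ.sum-cong-≗ (λ l → sumR-apply (suc q) (λ i → ωpow (x i + quotient i l)) t) ⟩
    ℤΣ.∑[ l < suc q ] ℤΣ.∑[ i < suc q ] ωpow (x i + quotient i l) t
      ≡⟨ ℤΣ.∑-comm (λ l i → ωpow (x i + quotient i l) t) ⟩
    ℤΣ.∑[ i < suc q ] ℤΣ.∑[ l < suc q ] ωpow (x i + quotient i l) t
      ≡⟨ ℤΣ.sum-cong-≗ (λ i → ∑-ωpow-quotients i t) ⟩
    ℤΣ.∑[ i < suc q ] (ℤ.1ℤ ℤ.- ωpow (x i) t)
      ≡⟨ ℤΣ.∑-distrib-+ (λ _ → ℤ.1ℤ) (λ i → ℤ.- ωpow (x i) t) ⟩
    ℤΣ.∑[ i < suc q ] ℤ.1ℤ ℤ.+ ℤΣ.∑[ i < suc q ] (ℤ.- ωpow (x i) t)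
      ≡⟨ cong₂ ℤ._+_ (trans (∑-const (suc q) 1) (cong ℤ.+_ (ℕ.*-identityʳ (suc q))))
                     (sym (ℤΣ.-‿distrib-sum (λ i → ωpow (x i) t))) ⟩
    ℤ.+ suc q ℤ.- ℤΣ.∑[ i < suc q ] ωpow (0 + suc (toℕ i)) t
      ≡⟨ cong (λ S → ℤ.+ suc q ℤ.- S) (∑-ωpow-nonzero 0 t) ⟩
    ℤ.+ suc q ℤ.- (ℤ.1ℤ ℤ.- ωpow 0 t)
      ≡⟨ cancel (ℤ.+ q) (ωpow 0 t) ⟩
    ℤ.+ q ℤ.+ ωpow 0 t
      ≡⟨ cong (λ w → ℤ.+ q ℤ.+ w) (ωpow-zero t) ⟩
    ℤ.+ q ℤ.+ const ℤ.1ℤ t ∎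
    where
    open ≡-Reasoning
    open Inverses using (x; quotient; ∑-ωpow-quotients)
    cancel : ∀ a w → (ℤ.1ℤ ℤ.+ a) ℤ.- (ℤ.1ℤ ℤ.- w) ≡ a ℤ.+ w
    cancel = solve-∀

module KloostermanDeterminants (q : ℕ) (p-prime : Prime (suc (suc q))) (g : ℕ)
                               (g-primitive : IsPrimitiveRoot (suc (suc q)) g) where
  open import Data.Nat as ℕ using (_∸_; _^_)
  open import Data.Nat.Tactic.RingSolver using (solve-∀)
  open import Data.Integer as ℤ using (ℤ; +_)
  import Data.Integer.Properties as ℤ
  open import Data.Fin using (Fin; zero; suc; toℕ)
  open import Relation.Binary.PropositionalEquality as ≡ using (_≡_; cong)
  open GroupRing (suc q)
  open Cyc p
  open CommutativeRing ring using (setoid; +-cong; +-congʳ; +-congˡ; *-congˡ; *-congʳ; +-assoc; distribʳ; distribˡ; *-identityˡ; *-comm)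
    renaming (trans to ≈-trans)
  open LeftCirculant ring x+x≗0⇒x≗0
  open KloostermanSum q p-prime g g-primitive using (∑-Kl)
  open import Relation.Binary.Reasoning.Setoid setoid

  a : ℕ → R
  a l = Kl (g ^ l)

  c : R
  c = const (+ (p ℕ.+ 1))

  P : R
  P = const (+ (p ^ 2))

  D : R
  D = RDet.det (suc q) (RDet.withRow₀ (leftCirculant q a) (λ _ → 1R))

  Sa Sc : R
  Sa = RΣ.∑[ l < suc q ] a (toℕ l)
  Sc = RΣ.∑[ l < suc q ] c

  W : ℤ
  W = + q ℤ.* ℤΣ.sum D

  Sa≗ : Sa ≗R flat (+ q) +R 1R
  Sa≗ t = ≡.trans (sum-apply {suc q} (λ l → a (toℕ l)) t) (∑-Kl t)

  1+Sc≗P : 1R +R Sc ≗R P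
  1+Sc≗P zero    = ≡.trans (cong (λ S → ℤ.1ℤ ℤ.+ S) (≡.trans (sum-apply {suc q} (λ _ → c) zero) (∑-const (suc q) (p ℕ.+ 1))))
                           (cong +_ (1+[p-1][p+1]≡p² q))
    where
    1+[p-1][p+1]≡p² : ∀ q → 1 ℕ.+ (1 ℕ.+ q) ℕ.* ((2 ℕ.+ q) ℕ.+ 1) ≡ (2 ℕ.+ q) ℕ.* ((2 ℕ.+ q) ℕ.* 1)
    1+[p-1][p+1]≡p² = solve-∀
  1+Sc≗P (suc t) = ≡.trans (ℤ.+-identityˡ (Sc (suc t)))
                   (≡.trans (sum-apply {suc q} (λ _ → c) (suc t)) (ℤΣ.sum-zero {suc q} {λ _ → ℤ.0ℤ} (λ _ → ≡.refl)))

  det-K≗ : det (p ∸ 1) (Kmat g) ≗R ((Sa +R Sc) *R D)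
  det-K≗ = ≈-trans (det≗RDet (suc q) (Kmat g)) (begin
    RDet.det (suc q) (leftCirculant q b)
      ≈⟨ det-leftCirculant q b ⟩
    ((RΣ.∑[ l < suc q ] b (toℕ l)) *R Db)
      ≈⟨ *-congʳ {Db} (RΣ.∑-distrib-+ {suc q} (λ l → a (toℕ l)) (λ _ → c)) ⟩
    ((Sa +R Sc) *R Db)
      ≈⟨ *-congˡ {Sa +R Sc} (det-withRow₀-ones-shift q a c) ⟩
    ((Sa +R Sc) *R D) ∎)
    where
    b : ℕ → R
    b l = a l +R c
    Db : R
    Db = RDet.det (suc q) (RDet.withRow₀ (leftCirculant q b) (λ _ → 1R))

  det-K′≗ : det (p ∸ 1) (Kmat' g) ≗R (Sa *R D)
  det-K′≗ = ≈-trans (det≗RDet (suc q) (Kmat' g)) (det-leftCirculant q a)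

  det-K-flat : det (p ∸ 1) (Kmat g) ≗R (flat W +R (P *R D))
  det-K-flat = begin
    det (p ∸ 1) (Kmat g)                      ≈⟨ det-K≗ ⟩
    ((Sa +R Sc) *R D)                         ≈⟨ *-congʳ {D} (+-congʳ {Sc} Sa≗) ⟩
    (((flat (+ q) +R 1R) +R Sc) *R D)         ≈⟨ *-congʳ {D} (+-assoc (flat (+ q)) 1R Sc) ⟩
    ((flat (+ q) +R (1R +R Sc)) *R D)         ≈⟨ *-congʳ {D} (+-congˡ {flat (+ q)} 1+Sc≗P) ⟩
    ((flat (+ q) +R P) *R D)                  ≈⟨ distribʳ D (flat (+ q)) P ⟩
    ((flat (+ q) *R D) +R (P *R D))           ≈⟨ +-congʳ {P *R D} (flat-*R (+ q) D) ⟩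
    (flat W +R (P *R D))                      ∎

  P*det-K′-flat : (P *R det (p ∸ 1) (Kmat' g)) ≗R (flat (W ℤ.* ℤΣ.sum P) +R (P *R D))
  P*det-K′-flat = begin
    (P *R det (p ∸ 1) (Kmat' g))              ≈⟨ *-congˡ {P} det-K′≗ ⟩
    (P *R (Sa *R D))                          ≈⟨ *-congˡ {P} (*-congʳ {D} Sa≗) ⟩
    (P *R ((flat (+ q) +R 1R) *R D))          ≈⟨ *-congˡ {P} (distribʳ D (flat (+ q)) 1R) ⟩
    (P *R ((flat (+ q) *R D) +R (1R *R D)))
      ≈⟨ *-congˡ {P} (+-cong {flat (+ q) *R D} {flat W} {1R *R D} {D} (flat-*R (+ q) D) (*-identityˡ D)) ⟩
    (P *R (flat W +R D))                      ≈⟨ distribˡ P (flat W) D ⟩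
    ((P *R flat W) +R (P *R D))               ≈⟨ +-congʳ {P *R D} (*-comm P (flat W)) ⟩
    ((flat W *R P) +R (P *R D))               ≈⟨ +-congʳ {P *R D} (flat-*R W P) ⟩
    (flat (W ℤ.* ℤΣ.sum P) +R (P *R D))       ∎

  det-K≈p²det-K′ : det (p ∸ 1) (Kmat g) ≈ (const (+ (p ^ 2)) *R det (p ∸ 1) (Kmat' g))
  det-K≈p²det-K′ = ≈-modulo-flat {h = P *R D} W (W ℤ.* ℤΣ.sum P) det-K-flat P*det-K′-flat

open import Data.Nat using (_∸_; _^_)
open import Data.Integer using (+_)

lemma3 : (p : ℕ) .{{_ : NonZero p}} → Prime p → (g : ℕ) → IsPrimitiveRoot p g →
    let open Cyc p in
    det (p ∸ 1) (Kmat g) ≈ (const (+ (p ^ 2)) *R det (p ∸ 1) (Kmat' g))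
lemma3 (suc zero) ()
lemma3 (suc (suc q)) p-prime g g-primitive = KloostermanDeterminants.det-K≈p²det-K′ q p-prime g g-primitive
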